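{- Let $a,b,c,e\in\mathbb Z$ with $a\neq 0$ and $e>0$, and let $h_3(j)=aj^3+bj^2+cj+e$ for $j\in\mathbb Z_{\geq 0}$, where it is assumed that $h_3(j)\geq 0$ for all $j\geq 0$. Put $\alpha=a/e$, $\beta=b/e$, $\gamma=c/e$, $\Delta(\alpha,\beta,\gamma)=(\alpha+\beta+\gamma)^2-15\alpha-7\beta-3\gamma-\frac{7}{4}$, $s_0=39+16\sqrt3$ and $t_0=\frac{s_0+\sqrt{s_0^2+8}}{2}$. If $b<0$ and $b^2\leq 3ac$, then $\Delta(\alpha,\beta,\gamma)>\frac{1}{4}$ whenever $\alpha+\beta+\gamma>t_0$. In particular, this inequality holds whenever $\alpha+\beta+\gamma\geq 67$. -}

module Defs where

open import Data.Nat using (ℕ; suc)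
open import Data.Integer as ℤ using (ℤ; +_; -[1+_])
open import Data.Rational as ℚ using (ℚ; _/_; 0ℚ; _+_; _-_; _*_; _<_; _≤_)
open import Data.Product using (_×_)
open import Data.Sum using (_⊎_)

-- Rational number x / y for integers x, y (y ≠ 0; the value at y = 0 is irrelevant).
divℤ : ℤ → ℤ → ℚ
divℤ x (+ 0)      = 0ℚ
divℤ x (+ suc k)  = x / suc k
divℤ x -[1+ k ]   = (ℤ.- x) / suc k

h₃ : ℤ → ℤ → ℤ → ℤ → ℕ → ℤ
h₃ a b c e j = a ℤ.* (+ j) ℤ.^ 3 ℤ.+ b ℤ.* (+ j) ℤ.^ 2 ℤ.+ c ℤ.* (+ j) ℤ.+ e

Δ : ℚ → ℚ → ℚ → ℚ
Δ α β γ = (α + β + γ) * (α + β + γ) - (+ 15 / 1) * α - (+ 7 / 1) * β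
          - (+ 3 / 1) * γ - (+ 7 / 4)

-- Comparison of a rational x with the real number p + q√3 (p, q ∈ ℚ):
-- x > p + q√3  ⟺  x − p > q√3.
_>[_+_√3] : ℚ → ℚ → ℚ → Set
x >[ p + q √3] =
  (0ℚ ≤ q × 0ℚ < x - p × (+ 3 / 1) * q * q < (x - p) * (x - p))
  ⊎ (q < 0ℚ × (0ℚ ≤ x - p ⊎ (x - p) * (x - p) < (+ 3 / 1) * q * q))

-- s₀ = 39 + 16√3, and t₀ = (s₀ + √(s₀² + 8))/2 is the positive root of
-- t² − s₀ t − 2 = 0 (the other root is negative, product −2). Hence for
-- rational x:  x > t₀  ⟺  x > 0 and x² − 2 > s₀ x = 39x + 16x√3.
_>t₀ : ℚ → Set
x >t₀ = 0ℚ < x × (x * x - (+ 2 / 1)) >[ (+ 39 / 1) * x + (+ 16 / 1) * x √3]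

{-# OPTIONS --safe #-}
-- Write x = α + β + γ. Completing the square gives
--   Δ(α,β,γ) = 1/4 + (x² − 39x − 2) + 4(6α + 8β + 9γ).
-- If x > t₀ then x² − 2 > s₀x ≥ 39x, so the middle term is positive. For the
-- last one, b² ≤ 3ac with b < 0 forces αγ > 0; as x > 0 and β < 0, both α and
-- γ are then positive, and
--   (6α + 9γ)² − (8β)² = (6α − 9γ)² + 24αγ + 64(3αγ − β²) ≥ 0
-- gives 6α + 9γ ≥ −8β.
module Submission where

open import Data.Nat as ℕ using (ℕ; suc)
import Data.Nat.Properties as ℕ
open import Data.Integer as ℤ using (ℤ; +_; -[1+_])
import Data.Integer.Properties as ℤ
open import Data.Rational as ℚ
  using ( ℚ; _/_; 0ℚ; _+_; _-_; _*_; -_; _≤_; _<_; toℚᵘ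
        ; positive; negative; nonNegative; nonPositive )
open import Data.Rational.Properties
open import Data.Rational.Solver using (module +-*-Solver)
open import Data.Rational.Unnormalised as ℚᵘ using (mkℚᵘ; *≤*; *<*)
import Data.Rational.Unnormalised.Properties as ℚᵘ
open import Data.Empty using (⊥-elim)
open import Data.Product using (_×_; _,_)
open import Data.Sum using (inj₁; inj₂)
open import Function using (_∘_)
open import Relation.Nullary using (¬_)
open import Relation.Binary.PropositionalEquality

open import Defs

private variable p q : ℚ

/-*-/ : ∀ i j m n → (i / suc m) * (j / suc n) ≡ (i ℤ.* j) / (suc m ℕ.* suc n)
/-*-/ i j m n = toℚᵘ-injective (begin
  toℚᵘ ((i / suc m) * (j / suc n))
    ≈⟨ toℚᵘ-homo-* (i / suc m) (j / suc n) ⟩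
  toℚᵘ (i / suc m) ℚᵘ.* toℚᵘ (j / suc n)
    ≈⟨ ℚᵘ.*-cong (toℚᵘ-fromℚᵘ (mkℚᵘ i m)) (toℚᵘ-fromℚᵘ (mkℚᵘ j n)) ⟩
  mkℚᵘ i m ℚᵘ.* mkℚᵘ j n
    ≈⟨ toℚᵘ-fromℚᵘ (mkℚᵘ i m ℚᵘ.* mkℚᵘ j n) ⟨
  toℚᵘ ((i ℤ.* j) / (suc m ℕ.* suc n))
    ∎)
  where open ℚᵘ.≃-Reasoning

/-monoˡ-≤ : ∀ {i j} n → i ℤ.≤ j → i / suc n ≤ j / suc n
/-monoˡ-≤ {i} {j} n i≤j = toℚᵘ-cancel-≤ (begin
  toℚᵘ (i / suc n)  ≃⟨ toℚᵘ-fromℚᵘ _ ⟩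
  mkℚᵘ i n          ≤⟨ *≤* (ℤ.*-monoʳ-≤-nonNeg (+ suc n) i≤j) ⟩
  mkℚᵘ j n          ≃⟨ toℚᵘ-fromℚᵘ _ ⟨
  toℚᵘ (j / suc n)  ∎)
  where open ℚᵘ.≤-Reasoning

/-monoˡ-< : ∀ {i j} n → i ℤ.< j → i / suc n < j / suc n
/-monoˡ-< {i} {j} n i<j = toℚᵘ-cancel-< (begin-strict
  toℚᵘ (i / suc n)  ≃⟨ toℚᵘ-fromℚᵘ _ ⟩
  mkℚᵘ i n          <⟨ *<* (ℤ.*-monoʳ-<-pos (+ suc n) i<j) ⟩
  mkℚᵘ j n          ≃⟨ toℚᵘ-fromℚᵘ _ ⟨
  toℚᵘ (j / suc n)  ∎)
  where open ℚᵘ.≤-Reasoning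

p≤q⇒0≤q-p : p ≤ q → 0ℚ ≤ q - p
p≤q⇒0≤q-p {p} {q} p≤q = begin
  0ℚ     ≡⟨ +-inverseʳ p ⟨
  p - p  ≤⟨ +-monoˡ-≤ (- p) p≤q ⟩
  q - p  ∎
  where open ≤-Reasoning

0≤q-p⇒p≤q : 0ℚ ≤ q - p → p ≤ q
0≤q-p⇒p≤q {q} {p} 0≤q-p = begin
  p              ≡⟨ +-identityˡ p ⟨
  0ℚ + p         ≤⟨ +-monoˡ-≤ p 0≤q-p ⟩
  q - p + p      ≡⟨ +-assoc q (- p) p ⟩
  q + (- p + p)  ≡⟨ cong (_+_ q) (+-inverseˡ p) ⟩
  q + 0ℚ         ≡⟨ +-identityʳ q ⟩
  q              ∎
  where open ≤-Reasoning

0≤p⇒0≤q⇒0≤p*q : 0ℚ ≤ p → 0ℚ ≤ q → 0ℚ ≤ p * q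
0≤p⇒0≤q⇒0≤p*q {p} {q} 0≤p 0≤q =
  nonNegative⁻¹ (p * q) {{nonNeg*nonNeg⇒nonNeg p {{nonNegative 0≤p}} q {{nonNegative 0≤q}}}}

0≤p*p : ∀ p → 0ℚ ≤ p * p
0≤p*p p with ≤-total 0ℚ p
... | inj₁ 0≤p = 0≤p⇒0≤q⇒0≤p*q 0≤p 0≤p
... | inj₂ p≤0 =
  nonNegative⁻¹ (p * p) {{nonPos*nonPos⇒nonPos p {{nonPositive p≤0}} p {{nonPositive p≤0}}}}

p*p≤q*q⇒p≤q : 0ℚ ≤ q → p * p ≤ q * q → p ≤ q
p*p≤q*q⇒p≤q {q} {p} 0≤q p*p≤q*q = ≮⇒≥ λ q<p → <-irrefl refl (begin-strict
  q * q  ≤⟨ *-monoˡ-≤-nonNeg q {{nonNegative 0≤q}} (<⇒≤ q<p) ⟩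
  q * p  <⟨ *-monoˡ-<-pos p {{positive (≤-<-trans 0≤q q<p)}} q<p ⟩
  p * p  ≤⟨ p*p≤q*q ⟩
  q * q  ∎)
  where open ≤-Reasoning

0<p*q⇒0<p+q⇒0≤p : 0ℚ < p * q → 0ℚ < p + q → 0ℚ ≤ p
0<p*q⇒0<p+q⇒0≤p {p} {q} 0<p*q 0<p+q with ≤-total 0ℚ p | ≤-total 0ℚ q
... | inj₁ 0≤p | _        = 0≤p
... | inj₂ p≤0 | inj₁ 0≤q = ⊥-elim (<-irrefl refl (<-≤-trans 0<p*q (nonPositive⁻¹ (p * q)
  {{nonPos*nonNeg⇒nonPos p {{nonPositive p≤0}} q {{nonNegative 0≤q}}}})))
... | inj₂ p≤0 | inj₂ q≤0 = ⊥-elim (<-irrefl refl (<-≤-trans 0<p+q (nonPositive⁻¹ (p + q)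
  {{nonPos+nonPos⇒nonPos p {{nonPositive p≤0}} q {{nonPositive q≤0}}}})))

α+β+γ-β≡α+γ : ∀ α β γ → α + β + γ + - β ≡ α + γ
α+β+γ-β≡α+γ = solve 3 (λ α β γ → α :+ β :+ γ :+ :- β := α :+ γ) refl
  where open +-*-Solver

6α+9γ-[-8β]≡6α+8β+9γ : ∀ α β γ →
  (+ 6 / 1) * α + (+ 9 / 1) * γ - - ((+ 8 / 1) * β)
  ≡ (+ 6 / 1) * α + (+ 8 / 1) * β + (+ 9 / 1) * γ
6α+9γ-[-8β]≡6α+8β+9γ = solve 3 (λ α β γ →
    con (+ 6 / 1) :* α :+ con (+ 9 / 1) :* γ :- :- (con (+ 8 / 1) :* β)
    := con (+ 6 / 1) :* α :+ con (+ 8 / 1) :* β :+ con (+ 9 / 1) :* γ) refl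
  where open +-*-Solver

[6α+9γ]²-[8β]²≡[6α-9γ]²+24αγ+64[3αγ-β²] : ∀ α β γ →
  ((+ 6 / 1) * α + (+ 9 / 1) * γ) * ((+ 6 / 1) * α + (+ 9 / 1) * γ)
    - - ((+ 8 / 1) * β) * - ((+ 8 / 1) * β)
  ≡ ((+ 6 / 1) * α - (+ 9 / 1) * γ) * ((+ 6 / 1) * α - (+ 9 / 1) * γ)
    + (+ 24 / 1) * (α * γ) + (+ 64 / 1) * ((+ 3 / 1) * α * γ - β * β)
[6α+9γ]²-[8β]²≡[6α-9γ]²+24αγ+64[3αγ-β²] = solve 3 (λ α β γ →
    (con (+ 6 / 1) :* α :+ con (+ 9 / 1) :* γ) :* (con (+ 6 / 1) :* α :+ con (+ 9 / 1) :* γ)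
      :- :- (con (+ 8 / 1) :* β) :* :- (con (+ 8 / 1) :* β)
    := (con (+ 6 / 1) :* α :- con (+ 9 / 1) :* γ) :* (con (+ 6 / 1) :* α :- con (+ 9 / 1) :* γ)
      :+ con (+ 24 / 1) :* (α :* γ) :+ con (+ 64 / 1) :* (con (+ 3 / 1) :* α :* γ :- β :* β))
    refl
  where open +-*-Solver

0≤6α+8β+9γ : ∀ α β γ → β < 0ℚ → β * β ≤ (+ 3 / 1) * α * γ → 0ℚ < α + β + γ →
             0ℚ ≤ (+ 6 / 1) * α + (+ 8 / 1) * β + (+ 9 / 1) * γ
0≤6α+8β+9γ α β γ β<0 β²≤3αγ 0<α+β+γ = begin
  0ℚ                                                  ≤⟨ p≤q⇒0≤q-p -8β≤6α+9γ ⟩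
  (+ 6 / 1) * α + (+ 9 / 1) * γ - - ((+ 8 / 1) * β)  ≡⟨ 6α+9γ-[-8β]≡6α+8β+9γ α β γ ⟩
  (+ 6 / 1) * α + (+ 8 / 1) * β + (+ 9 / 1) * γ      ∎
  where
  open ≤-Reasoning

  0<αγ : 0ℚ < α * γ
  0<αγ = *-cancelˡ-<-nonNeg (+ 3 / 1) {0ℚ} (begin-strict
    0ℚ                   <⟨ positive⁻¹ (β * β) {{neg*neg⇒pos β {{negative β<0}} β {{negative β<0}}}} ⟩
    β * β                ≤⟨ β²≤3αγ ⟩
    (+ 3 / 1) * α * γ    ≡⟨ *-assoc (+ 3 / 1) α γ ⟩
    (+ 3 / 1) * (α * γ)  ∎)

  0<α+γ : 0ℚ < α + γ
  0<α+γ = begin-strict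
    0ℚ               <⟨ +-mono-< 0<α+β+γ (neg-antimono-< β<0) ⟩
    α + β + γ + - β  ≡⟨ α+β+γ-β≡α+γ α β γ ⟩
    α + γ            ∎

  0≤α : 0ℚ ≤ α
  0≤α = 0<p*q⇒0<p+q⇒0≤p 0<αγ 0<α+γ

  0≤γ : 0ℚ ≤ γ
  0≤γ = 0<p*q⇒0<p+q⇒0≤p (subst (0ℚ <_) (*-comm α γ) 0<αγ) (subst (0ℚ <_) (+-comm α γ) 0<α+γ)

  0≤6α+9γ : 0ℚ ≤ (+ 6 / 1) * α + (+ 9 / 1) * γ
  0≤6α+9γ = +-mono-≤ (*-monoˡ-≤-nonNeg (+ 6 / 1) 0≤α) (*-monoˡ-≤-nonNeg (+ 9 / 1) 0≤γ)

  -8β≤6α+9γ : - ((+ 8 / 1) * β) ≤ (+ 6 / 1) * α + (+ 9 / 1) * γ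
  -8β≤6α+9γ = p*p≤q*q⇒p≤q 0≤6α+9γ (0≤q-p⇒p≤q (begin
    0ℚ
      ≤⟨ +-mono-≤ (+-mono-≤ (0≤p*p ((+ 6 / 1) * α - (+ 9 / 1) * γ))
                            (*-monoˡ-≤-nonNeg (+ 24 / 1) (<⇒≤ 0<αγ)))
                  (*-monoˡ-≤-nonNeg (+ 64 / 1) (p≤q⇒0≤q-p β²≤3αγ)) ⟩
    ((+ 6 / 1) * α - (+ 9 / 1) * γ) * ((+ 6 / 1) * α - (+ 9 / 1) * γ)
      + (+ 24 / 1) * (α * γ) + (+ 64 / 1) * ((+ 3 / 1) * α * γ - β * β)
      ≡⟨ [6α+9γ]²-[8β]²≡[6α-9γ]²+24αγ+64[3αγ-β²] α β γ ⟨
    ((+ 6 / 1) * α + (+ 9 / 1) * γ) * ((+ 6 / 1) * α + (+ 9 / 1) * γ)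
      - - ((+ 8 / 1) * β) * - ((+ 8 / 1) * β)
      ∎))

-- t₁ is the positive root of t² − 39t − 2; it lies below t₀ because s₀ > 39.
_>t₁ : ℚ → Set
x >t₁ = 0ℚ < x × 0ℚ < x * x - (+ 2 / 1) - (+ 39 / 1) * x

Δ≡¼+[x²-2-39x]+4[6α+8β+9γ] : ∀ α β γ →
  (α + β + γ) * (α + β + γ) - (+ 15 / 1) * α - (+ 7 / 1) * β - (+ 3 / 1) * γ - (+ 7 / 4)
  ≡ (+ 1 / 4) + ((α + β + γ) * (α + β + γ) - (+ 2 / 1) - (+ 39 / 1) * (α + β + γ)
                 + (+ 4 / 1) * ((+ 6 / 1) * α + (+ 8 / 1) * β + (+ 9 / 1) * γ))
Δ≡¼+[x²-2-39x]+4[6α+8β+9γ] = solve 3 (λ α β γ →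
    (α :+ β :+ γ) :* (α :+ β :+ γ) :- con (+ 15 / 1) :* α :- con (+ 7 / 1) :* β
      :- con (+ 3 / 1) :* γ :- con (+ 7 / 4)
    := con (+ 1 / 4)
      :+ ((α :+ β :+ γ) :* (α :+ β :+ γ) :- con (+ 2 / 1) :- con (+ 39 / 1) :* (α :+ β :+ γ)
          :+ con (+ 4 / 1) :* (con (+ 6 / 1) :* α :+ con (+ 8 / 1) :* β :+ con (+ 9 / 1) :* γ)))
    refl
  where open +-*-Solver

Δ>¼ : ∀ α β γ → β < 0ℚ → β * β ≤ (+ 3 / 1) * α * γ → (α + β + γ) >t₁ →
      (+ 1 / 4) < Δ α β γ
Δ>¼ α β γ β<0 β²≤3αγ (0<x , 0<x²-2-39x) = begin-strict
  (+ 1 / 4)       ≡⟨ +-identityʳ (+ 1 / 4) ⟨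
  (+ 1 / 4) + 0ℚ  <⟨ +-monoʳ-< (+ 1 / 4) 0<x²-2-39x+4L ⟩
  (+ 1 / 4) + (x * x - (+ 2 / 1) - (+ 39 / 1) * x + (+ 4 / 1) * L)
    ≡⟨ Δ≡¼+[x²-2-39x]+4[6α+8β+9γ] α β γ ⟨
  Δ α β γ
    ∎
  where
  open ≤-Reasoning
  x L : ℚ
  x = α + β + γ
  L = (+ 6 / 1) * α + (+ 8 / 1) * β + (+ 9 / 1) * γ
  0<x²-2-39x+4L : 0ℚ < x * x - (+ 2 / 1) - (+ 39 / 1) * x + (+ 4 / 1) * L
  0<x²-2-39x+4L = +-mono-<-≤ 0<x²-2-39x
    (*-monoˡ-≤-nonNeg (+ 4 / 1) (0≤6α+8β+9γ α β γ β<0 β²≤3αγ 0<x))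

>[p+q√3]⇒0<x-p : ∀ {x p q} → 0ℚ ≤ q → x >[ p + q √3] → 0ℚ < x - p
>[p+q√3]⇒0<x-p _   (inj₁ (_ , 0<x-p , _)) = 0<x-p
>[p+q√3]⇒0<x-p 0≤q (inj₂ (q<0 , _))       = ⊥-elim (<-irrefl refl (<-≤-trans q<0 0≤q))

>t₀⇒>t₁ : ∀ {x} → x >t₀ → x >t₁
>t₀⇒>t₁ {x} (0<x , x²-2>s₀x) =
  0<x , >[p+q√3]⇒0<x-p {x * x - (+ 2 / 1)} {(+ 39 / 1) * x}
                       (*-monoˡ-≤-nonNeg (+ 16 / 1) (<⇒≤ 0<x)) x²-2>s₀x

x²-2-39x≡1874+[x-67]²+95[x-67] : ∀ x →
  x * x - (+ 2 / 1) - (+ 39 / 1) * x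
  ≡ (+ 1874 / 1) + ((x - (+ 67 / 1)) * (x - (+ 67 / 1)) + (+ 95 / 1) * (x - (+ 67 / 1)))
x²-2-39x≡1874+[x-67]²+95[x-67] = solve 1 (λ x →
    x :* x :- con (+ 2 / 1) :- con (+ 39 / 1) :* x
    := con (+ 1874 / 1)
      :+ ((x :- con (+ 67 / 1)) :* (x :- con (+ 67 / 1)) :+ con (+ 95 / 1) :* (x :- con (+ 67 / 1))))
    refl
  where open +-*-Solver

67≤x⇒>t₁ : ∀ {x} → (+ 67 / 1) ≤ x → x >t₁
67≤x⇒>t₁ {x} 67≤x = <-≤-trans (positive⁻¹ (+ 67 / 1)) 67≤x , (begin-strict
  0ℚ
    <⟨ +-mono-<-≤ (positive⁻¹ (+ 1874 / 1))
                  (+-mono-≤ (0≤p*p t) (*-monoˡ-≤-nonNeg (+ 95 / 1) (p≤q⇒0≤q-p 67≤x))) ⟩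
  (+ 1874 / 1) + (t * t + (+ 95 / 1) * t)  ≡⟨ x²-2-39x≡1874+[x-67]²+95[x-67] x ⟨
  x * x - (+ 2 / 1) - (+ 39 / 1) * x       ∎)
  where
  open ≤-Reasoning
  t : ℚ
  t = x - (+ 67 / 1)

b*b≤3ac⇒β*β≤3αγ : ∀ a b c k → b ℤ.* b ℤ.≤ + 3 ℤ.* a ℤ.* c →
                  (b / suc k) * (b / suc k) ≤ (+ 3 / 1) * (a / suc k) * (c / suc k)
b*b≤3ac⇒β*β≤3αγ a b c k b*b≤3ac = begin
  (b / suc k) * (b / suc k)                    ≡⟨ /-*-/ b b k k ⟩
  (b ℤ.* b) / (suc k ℕ.* suc k)                ≤⟨ /-monoˡ-≤ _ b*b≤3ac ⟩
  (+ 3 ℤ.* a ℤ.* c) / (suc k ℕ.* suc k)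
    ≡⟨ /-cong {+ 3 ℤ.* a ℤ.* c} refl (cong (ℕ._* suc k) (ℕ.*-identityˡ (suc k))) ⟨
  (+ 3 ℤ.* a ℤ.* c) / (1 ℕ.* suc k ℕ.* suc k)  ≡⟨ /-*-/ (+ 3 ℤ.* a) c _ k ⟨
  ((+ 3 ℤ.* a) / (1 ℕ.* suc k)) * (c / suc k)  ≡⟨ cong (_* (c / suc k)) (/-*-/ (+ 3) a 0 k) ⟨
  (+ 3 / 1) * (a / suc k) * (c / suc k)        ∎
  where open ≤-Reasoning

lemma3p4 : (a b c e : ℤ) → ¬ (a ≡ + 0) → + 0 ℤ.< e →
           ((j : ℕ) → + 0 ℤ.≤ h₃ a b c e j) →
           b ℤ.< + 0 → b ℤ.* b ℤ.≤ + 3 ℤ.* a ℤ.* c →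
           ((divℤ a e ℚ.+ divℤ b e ℚ.+ divℤ c e) >t₀ →
              (+ 1 / 4) ℚ.< Δ (divℤ a e) (divℤ b e) (divℤ c e))
           × ((+ 67 / 1) ℚ.≤ divℤ a e ℚ.+ divℤ b e ℚ.+ divℤ c e →
              (+ 1 / 4) ℚ.< Δ (divℤ a e) (divℤ b e) (divℤ c e))
lemma3p4 a b c (+ 0)     _ (ℤ.+<+ ()) _ _ _
lemma3p4 a b c -[1+ _ ]  _ ()         _ _ _
lemma3p4 a b c (+ suc k) _ _ _ b<0 b*b≤3ac = x>t₁⇒Δ>¼ ∘ >t₀⇒>t₁ , x>t₁⇒Δ>¼ ∘ 67≤x⇒>t₁
  where
  α β γ : ℚ
  α = a / suc k
  β = b / suc k
  γ = c / suc k

  β<0 : β < 0ℚ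
  β<0 = subst (β <_) (0/n≡0 (suc k)) (/-monoˡ-< k b<0)

  x>t₁⇒Δ>¼ : (α + β + γ) >t₁ → (+ 1 / 4) < Δ α β γ
  x>t₁⇒Δ>¼ = Δ>¼ α β γ β<0 (b*b≤3ac⇒β*β≤3αγ a b c k b*b≤3ac)
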